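{- Let $n_1,n_2,n_3$ be positive integers with $n_1+n_2+n_3 \ge 5$, and let $D$ be an orientation of the complete tripartite graph $K_{n_1,n_2,n_3}$ in which no two distinct vertices are true twins. Then the niche graph of $D$ is connected.
   Context: The niche graph $\mathcal{N}(D)$ of a digraph $D$ has vertex set $V(D)$, and two distinct vertices are adjacent iff they have a common out-neighbor in $D$ or a common in-neighbor in $D$. Two vertices $u,v$ of $D$ are true twins in $D$ if $N^+_D(u)=N^+_D(v)$ and $N^-_D(u)=N^-_D(v)$. -}

module Defs where

open import Data.Nat using (ℕ)
open import Data.Fin using (Fin)
open import Data.Product using (Σ; _×_; proj₁)
open import Data.Sum using (_⊎_)
open import Relation.Nullary using (¬_)
open import Relation.Binary.PropositionalEquality using (_≡_)
open import Relation.Binary.Construct.Closure.ReflexiveTransitive using (Star)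
open import Function.Bundles using (_⇔_)

Vertex : (Fin 3 → ℕ) → Set
Vertex n = Σ (Fin 3) (λ i → Fin (n i))

Digraph : Set → Set₁
Digraph V = V → V → Set

IsOrientationOfK3 : (n : Fin 3 → ℕ) → Digraph (Vertex n) → Set
IsOrientationOfK3 n D =
  (∀ u v → proj₁ u ≡ proj₁ v → ¬ D u v) ×
  (∀ u v → ¬ (proj₁ u ≡ proj₁ v) → D u v ⊎ D v u) ×
  (∀ u v → ¬ (D u v × D v u))

NicheAdj : {V : Set} → Digraph V → V → V → Set
NicheAdj {V} D u v =
  ¬ (u ≡ v) × ((Σ V λ w → D u w × D v w) ⊎ (Σ V λ w → D w u × D w v))

TrueTwins : {V : Set} → Digraph V → V → V → Set
TrueTwins {V} D u v = (∀ w → D u w ⇔ D v w) × (∀ w → D w u ⇔ D w v)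

Connected : {V : Set} → (V → V → Set) → Set
Connected {V} E = ∀ u v → Star E u v

-- If some arc x → y of D is joined by no niche walk with at most four edges, every vertex w
-- of the third part satisfies w → x and y → w, and two such vertices have the same
-- out-neighbourhood (a 2-path through the third part would give a walk x – t – y), so the
-- third part is a single vertex w₀.  Every other vertex is an out- or in-neighbour of w₀,
-- and excluding short walks forces every arc between the parts i ∋ x and j ∋ y to go forward
-- along the chain out-j, out-i, in-j, in-i of these classes.  Vertices of one class are then
-- twins, and in-i and out-j are not both inhabited, leaving at most four vertices.  So every
-- arc lies on a short niche walk, which connects vertices of different parts; two vertices of
-- one part are connected through a vertex of another part.
module Submission where

open import Defs
open import Data.Nat using (ℕ; zero; suc; _+_; _≤_; _<_)
open import Data.Nat.Properties using (≤-trans; n≮n)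
open import Data.Fin using (Fin; zero; suc; fromℕ<; splitAt; _↑ˡ_; _↑ʳ_; punchIn)
open import Data.Fin.Patterns using (0F; 1F; 2F)
open import Data.Fin.Properties
  using (any?; all?; injective⇒≤; splitAt⁻¹-↑ˡ; splitAt⁻¹-↑ʳ; punchInᵢ≢i)
  renaming (_≟_ to _≟ᶠ_)
open import Data.List using (List; []; _∷_; length; lookup)
open import Data.List.Membership.Propositional using (_∈_)
open import Data.List.Relation.Unary.Any using (here; there; index)
open import Data.List.Relation.Unary.Any.Properties using (lookup-index)
open import Data.Product using (Σ; ∃; _×_; _,_; proj₁; proj₂)
open import Data.Product.Properties using (≡-dec)
open import Data.Sum using (_⊎_; inj₁; inj₂)
open import Data.Empty using (⊥; ⊥-elim)
open import Function.Base using (_∘_)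
open import Function.Bundles using (mk⇔)
open import Relation.Nullary using (¬_; Dec; yes; no)
open import Relation.Nullary.Decidable using (_×-dec_; _⊎-dec_; _→-dec_; ¬?; from-yes)
open import Relation.Unary using (Pred) renaming (Decidable to Decidable₁)
open import Level using (0ℓ)
open import Relation.Binary.Core using (Rel)
open import Relation.Binary.Definitions using (Decidable; DecidableEquality; Symmetric)
open import Relation.Binary.PropositionalEquality using (_≡_; _≢_; refl; sym; trans; cong; module ≡-Reasoning)
open import Relation.Binary.Construct.Closure.ReflexiveTransitive using (Star; ε; _◅_; _◅◅_; reverse)

Searchable : Set → Set₁
Searchable V = {P : Pred V 0ℓ} → Decidable₁ P → Dec (∃ P)

data Walk≤ {V : Set} (E : Rel V 0ℓ) : ℕ → V → V → Set where
  []  : ∀ {k u} → Walk≤ E k u u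
  _∷_ : ∀ {k u v w} → E u v → Walk≤ E k v w → Walk≤ E (suc k) u w

module _ {V : Set} {E : Rel V 0ℓ} where

  Walk≤⇒Star : ∀ {k u v} → Walk≤ E k u v → Star E u v
  Walk≤⇒Star []       = ε
  Walk≤⇒Star (e ∷ es) = e ◅ Walk≤⇒Star es

  Walk≤-suc : ∀ {k u v} → Walk≤ E k u v → Walk≤ E (suc k) u v
  Walk≤-suc []       = []
  Walk≤-suc (e ∷ es) = e ∷ Walk≤-suc es

  walk? : DecidableEquality V → Searchable V → Decidable E → ∀ k → Decidable (Walk≤ E k)
  walk? _≟_ search E? k u v with u ≟ v
  ... | yes refl = yes []
  walk? _≟_ search E? zero    u v | no u≢v = no λ { [] → u≢v refl }
  walk? _≟_ search E? (suc k) u v | no u≢v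
    with search (λ w → E? u w ×-dec walk? _≟_ search E? k w v)
  ... | yes (w , e , es) = yes (e ∷ es)
  ... | no ∄w = no λ { [] → u≢v refl ; (e ∷ es) → ∄w (_ , e , es) }

module _ {V : Set} (D : Digraph V) where

  NicheWalk≤ : ℕ → V → V → Set
  NicheWalk≤ = Walk≤ (NicheAdj D)

  niche-sym : Symmetric (NicheAdj D)
  niche-sym (u≢v , inj₁ (w , uw , vw)) = u≢v ∘ sym , inj₁ (w , vw , uw)
  niche-sym (u≢v , inj₂ (w , wu , wv)) = u≢v ∘ sym , inj₂ (w , wv , wu)

  niche? : DecidableEquality V → Searchable V → Decidable D → Decidable (NicheAdj D)
  niche? _≟_ search D? u v =
    ¬? (u ≟ v) ×-dec (search (λ w → D? u w ×-dec D? v w) ⊎-dec search (λ w → D? w u ×-dec D? w v))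

  module NicheSteps (_≟_ : DecidableEquality V) where

    via-out : ∀ {k u v w z} → D u w → D v w → NicheWalk≤ k v z → NicheWalk≤ (suc k) u z
    via-out {u = u} {v} {w} uw vw walk with u ≟ v
    ... | yes refl = Walk≤-suc walk
    ... | no u≢v   = (u≢v , inj₁ (w , uw , vw)) ∷ walk

    via-in : ∀ {k u v w z} → D w u → D w v → NicheWalk≤ k v z → NicheWalk≤ (suc k) u z
    via-in {u = u} {v} {w} wu wv walk with u ≟ v
    ... | yes refl = Walk≤-suc walk
    ... | no u≢v   = (u≢v , inj₂ (w , wu , wv)) ∷ walk

-- The part other than i and j; a junk value when i ≡ j.
third : Fin 3 → Fin 3 → Fin 3
third 0F 1F = 2F
third 1F 0F = 2F
third 0F 2F = 1F
third 2F 0F = 1F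
third _  _  = 0F

third-≢ˡ : ∀ i j → i ≢ j → third i j ≢ i
third-≢ˡ = from-yes (all? λ i → all? λ j → ¬? (i ≟ᶠ j) →-dec ¬? (third i j ≟ᶠ i))

third-≢ʳ : ∀ i j → i ≢ j → third i j ≢ j
third-≢ʳ = from-yes (all? λ i → all? λ j → ¬? (i ≟ᶠ j) →-dec ¬? (third i j ≟ᶠ j))

third-unique : ∀ i j t → i ≢ j → t ≢ i → t ≢ j → t ≡ third i j
third-unique = from-yes (all? λ i → all? λ j → all? λ t →
  ¬? (i ≟ᶠ j) →-dec (¬? (t ≟ᶠ i) →-dec (¬? (t ≟ᶠ j) →-dec (t ≟ᶠ third i j))))

module _ {n : Fin 3 → ℕ} where

  _≟ᵛ_ : DecidableEquality (Vertex n)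
  _≟ᵛ_ = ≡-dec _≟ᶠ_ _≟ᶠ_

  vertex-search : Searchable (Vertex n)
  vertex-search P? with any? (λ i → any? (λ a → P? (i , a)))
  ... | yes (i , a , p) = yes ((i , a) , p)
  ... | no ∄v           = no λ { ((i , a) , p) → ∄v (i , a , p) }

  private
    total : ℕ
    total = n 0F + n 1F + n 2F

    toVertex : Fin total → Vertex n
    toVertex f with splitAt (n 0F + n 1F) f
    ... | inj₂ c = 2F , c
    ... | inj₁ g with splitAt (n 0F) g
    ...   | inj₁ a = 0F , a
    ...   | inj₂ b = 1F , b

    fromVertex : Vertex n → Fin total
    fromVertex (0F , a) = (a ↑ˡ n 1F) ↑ˡ n 2F
    fromVertex (1F , b) = (n 0F ↑ʳ b) ↑ˡ n 2F
    fromVertex (2F , c) = (n 0F + n 1F) ↑ʳ c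

    fromVertex-toVertex : ∀ f → fromVertex (toVertex f) ≡ f
    fromVertex-toVertex f with splitAt (n 0F + n 1F) f in split-f
    ... | inj₂ c = splitAt⁻¹-↑ʳ split-f
    ... | inj₁ g with splitAt (n 0F) g in split-g
    ...   | inj₁ a = trans (cong (_↑ˡ n 2F) (splitAt⁻¹-↑ˡ split-g)) (splitAt⁻¹-↑ˡ split-f)
    ...   | inj₂ b = trans (cong (_↑ˡ n 2F) (splitAt⁻¹-↑ʳ split-g)) (splitAt⁻¹-↑ˡ split-f)

  vertex-count-≤ : (L : List (Vertex n)) → (∀ v → v ∈ L) →
                   n 0F + n 1F + n 2F ≤ length L
  vertex-count-≤ L ∈L = injective⇒≤ position-injective
    where
      position : Fin total → Fin (length L)
      position f = index (∈L (toVertex f))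

      position-injective : ∀ {f g} → position f ≡ position g → f ≡ g
      position-injective {f} {g} eq = begin
        f                                  ≡⟨ sym (fromVertex-toVertex f) ⟩
        fromVertex (toVertex f)            ≡⟨ cong fromVertex (lookup-index (∈L (toVertex f))) ⟩
        fromVertex (lookup L (position f)) ≡⟨ cong (fromVertex ∘ lookup L) eq ⟩
        fromVertex (lookup L (position g)) ≡⟨ cong fromVertex (sym (lookup-index (∈L (toVertex g)))) ⟩
        fromVertex (toVertex g)            ≡⟨ fromVertex-toVertex g ⟩
        g                                  ∎
        where open ≡-Reasoning

module Orientation {n : Fin 3 → ℕ} {D : Digraph (Vertex n)} (orient : IsOrientationOfK3 n D) where

  part : Vertex n → Fin 3
  part = proj₁

  arc⇒parts-≢ : ∀ {u v} → D u v → part u ≢ part v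
  arc⇒parts-≢ {u} {v} uv same = proj₁ orient u v same uv

  arc-asym : ∀ {u v} → D u v → ¬ D v u
  arc-asym {u} {v} uv vu = proj₂ (proj₂ orient) u v (uv , vu)

  arc-total : ∀ {u v} → part u ≢ part v → D u v ⊎ D v u
  arc-total {u} {v} = proj₁ (proj₂ orient) u v

  ¬arc⇒arc : ∀ {u v} → part u ≢ part v → ¬ D u v → D v u
  ¬arc⇒arc u≁v ¬uv with arc-total u≁v
  ... | inj₁ uv = ⊥-elim (¬uv uv)
  ... | inj₂ vu = vu

  arc? : Decidable D
  arc? u v with part u ≟ᶠ part v
  ... | yes same = no (λ uv → arc⇒parts-≢ uv same)
  ... | no u≁v with arc-total u≁v
  ...   | inj₁ uv = yes uv
  ...   | inj₂ vu = no (arc-asym vu)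

  -- Within a part the in-neighbourhood is the complement of the out-neighbourhood.
  same-out⇒twins : ∀ {a b} → part a ≡ part b →
                   (∀ {t} → D a t → D b t) → (∀ {t} → D b t → D a t) → TrueTwins D a b
  same-out⇒twins {a} {b} ab a⊆b b⊆a =
    (λ t → mk⇔ a⊆b b⊆a) , (λ t → mk⇔ (in-from b⊆a ab) (in-from a⊆b (sym ab)))
    where
      in-from : ∀ {a b t} → (∀ {t} → D b t → D a t) → part a ≡ part b → D t a → D t b
      in-from {a} {b} {t} b⊆a ab ta with arc? t b
      ... | yes tb = tb
      ... | no ¬tb = ⊥-elim (arc-asym ta (b⊆a (¬arc⇒arc (λ tb → arc⇒parts-≢ ta (trans tb (sym ab))) ¬tb)))

module NoShortWalk {n : Fin 3 → ℕ} (positive : ∀ i → 0 < n i)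
  {D : Digraph (Vertex n)} (orient : IsOrientationOfK3 n D)
  (twin-free : ∀ u v → u ≢ v → ¬ TrueTwins D u v)
  {x y : Vertex n} (xy : D x y) (no-walk : ¬ NicheWalk≤ D 4 x y) where

  open Orientation orient

  same-out⇒≡ : ∀ {a b} → part a ≡ part b →
               (∀ {t} → D a t → D b t) → (∀ {t} → D b t → D a t) → a ≡ b
  same-out⇒≡ {a} {b} ab a⊆b b⊆a with a ≟ᵛ b
  ... | yes a≡b = a≡b
  ... | no a≢b  = ⊥-elim (twin-free a b a≢b (same-out⇒twins ab a⊆b b⊆a))

  open NicheSteps D _≟ᵛ_

  i j k : Fin 3
  i = part x
  j = part y
  k = third i j

  i≢j : i ≢ j
  i≢j = arc⇒parts-≢ xy

  k≢i : k ≢ i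
  k≢i = third-≢ˡ i j i≢j

  k≢j : k ≢ j
  k≢j = third-≢ʳ i j i≢j

  parts-≢ : ∀ {c c′ d d′ : Fin 3} → c ≡ d → c′ ≡ d′ → d ≢ d′ → c ≢ c′
  parts-≢ refl refl d≢d′ = d≢d′

  third-part-arcs : ∀ {w} → part w ≡ k → D w x × D y w
  third-part-arcs {w} w∈k with arc-total {x} {w} (parts-≢ refl w∈k (k≢i ∘ sym))
                              | arc-total {y} {w} (parts-≢ refl w∈k (k≢j ∘ sym))
  ... | inj₁ xw | inj₁ yw = ⊥-elim (no-walk (via-out xw yw []))
  ... | inj₁ xw | inj₂ wy = ⊥-elim (no-walk (via-out xy wy (via-in xw xy [])))
  ... | inj₂ wx | inj₂ wy = ⊥-elim (no-walk (via-in wx wy []))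
  ... | inj₂ wx | inj₁ yw = wx , yw

  w₀ : Vertex n
  w₀ = k , fromℕ< (positive k)

  third-part-same-out : ∀ {a b t} → part a ≡ k → part b ≡ k → D a t → D b t
  third-part-same-out {a} {b} {t} a∈k b∈k at with arc? b t
  ... | yes bt = bt
  ... | no ¬bt = ⊥-elim (no-walk (via-in (proj₁ (third-part-arcs a∈k)) at
                                   (via-out tb (proj₂ (third-part-arcs b∈k)) [])))
    where
      tb : D t b
      tb = ¬arc⇒arc (λ b≈t → arc⇒parts-≢ at (trans a∈k (trans (sym b∈k) b≈t))) ¬bt

  third-part-singleton : ∀ {w} → part w ≡ k → w ≡ w₀
  third-part-singleton w∈k =
    same-out⇒≡ w∈k (third-part-same-out w∈k refl) (third-part-same-out refl w∈k)

  w₀x : D w₀ x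
  w₀x = proj₁ (third-part-arcs refl)

  yw₀ : D y w₀
  yw₀ = proj₂ (third-part-arcs refl)

  no-common-out : ∀ {p q t} → D w₀ p → D q w₀ → D p t → D q t → ⊥
  no-common-out w₀p qw₀ pt qt = no-walk (via-in w₀x w₀p (via-out pt qt (via-out qw₀ yw₀ [])))

  no-common-in : ∀ {p q t} → D w₀ p → D q w₀ → D t p → D t q → ⊥
  no-common-in w₀p qw₀ tp tq = no-walk (via-in w₀x w₀p (via-in tp tq (via-out qw₀ yw₀ [])))

  out⇒in : ∀ {p q} → D w₀ p → D q w₀ → part p ≢ part q → D p q
  out⇒in {p} {q} w₀p qw₀ p≁q with arc? p q
  ... | yes pq = pq
  ... | no ¬pq = ⊥-elim (no-walk (via-in w₀x w₀p (via-in qp qw₀ (via-out w₀p qp (via-out qw₀ yw₀ [])))))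
    where
      qp : D q p
      qp = ¬arc⇒arc p≁q ¬pq

  i≁j : ∀ {c d} → c ≡ i → d ≡ j → c ≢ d
  i≁j c≡i d≡j = parts-≢ c≡i d≡j i≢j

  j≁i : ∀ {c d} → c ≡ j → d ≡ i → c ≢ d
  j≁i c≡j d≡i = parts-≢ c≡j d≡i (i≢j ∘ sym)

  out-j⇒out-i : ∀ {p t} → part p ≡ i → part t ≡ j → D w₀ p → D w₀ t → D t p
  out-j⇒out-i {p} {t} p∈i t∈j w₀p w₀t with arc? t p
  ... | yes tp = tp
  ... | no ¬tp = ⊥-elim (no-common-in w₀t yw₀ pt (out⇒in w₀p yw₀ (i≁j p∈i refl)))
    where
      pt : D p t
      pt = ¬arc⇒arc (j≁i t∈j p∈i) ¬tp

  in-j⇒in-i : ∀ {p t} → part p ≡ i → part t ≡ j → D p w₀ → D t w₀ → D t p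
  in-j⇒in-i {p} {t} p∈i t∈j pw₀ tw₀ with arc? t p
  ... | yes tp = tp
  ... | no ¬tp = ⊥-elim (no-common-out w₀x pw₀ (out⇒in w₀x tw₀ (i≁j refl t∈j)) pt)
    where
      pt : D p t
      pt = ¬arc⇒arc (j≁i t∈j p∈i) ¬tp

  ¬in-i×out-j : ∀ {q r} → part q ≡ i → part r ≡ j → D q w₀ → D w₀ r → ⊥
  ¬in-i×out-j q∈i r∈j qw₀ w₀r =
    no-common-in w₀x qw₀ (out-j⇒out-i refl r∈j w₀x w₀r) (out⇒in w₀r qw₀ (j≁i r∈j q∈i))

  data Place (t : Vertex n) : Set where
    at-w₀ : t ≡ w₀ → Place t
    out-i : part t ≡ i → D w₀ t → Place t
    in-i  : part t ≡ i → D t w₀ → Place t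
    out-j : part t ≡ j → D w₀ t → Place t
    in-j  : part t ≡ j → D t w₀ → Place t

  place : ∀ t → Place t
  place t with part t ≟ᶠ i
  ... | yes t∈i with arc-total {w₀} {t} (parts-≢ refl t∈i k≢i)
  ...   | inj₁ w₀t = out-i t∈i w₀t
  ...   | inj₂ tw₀ = in-i t∈i tw₀
  place t | no t∉i with part t ≟ᶠ j
  ... | yes t∈j with arc-total {w₀} {t} (parts-≢ refl t∈j k≢j)
  ...   | inj₁ w₀t = out-j t∈j w₀t
  ...   | inj₂ tw₀ = in-j t∈j tw₀
  place t | no t∉i | no t∉j = at-w₀ (third-part-singleton (third-unique i j (part t) i≢j t∉i t∉j))

  data SameClass (a b : Vertex n) : Set where
    both-out-i : part a ≡ i → part b ≡ i → D w₀ a → D w₀ b → SameClass a b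
    both-in-i  : part a ≡ i → part b ≡ i → D a w₀ → D b w₀ → SameClass a b
    both-out-j : part a ≡ j → part b ≡ j → D w₀ a → D w₀ b → SameClass a b
    both-in-j  : part a ≡ j → part b ≡ j → D a w₀ → D b w₀ → SameClass a b

  SameClass-sym : ∀ {a b} → SameClass a b → SameClass b a
  SameClass-sym (both-out-i a∈i b∈i w₀a w₀b) = both-out-i b∈i a∈i w₀b w₀a
  SameClass-sym (both-in-i  a∈i b∈i aw₀ bw₀) = both-in-i  b∈i a∈i bw₀ aw₀
  SameClass-sym (both-out-j a∈j b∈j w₀a w₀b) = both-out-j b∈j a∈j w₀b w₀a
  SameClass-sym (both-in-j  a∈j b∈j aw₀ bw₀) = both-in-j  b∈j a∈j bw₀ aw₀

  SameClass⇒same-part : ∀ {a b} → SameClass a b → part a ≡ part b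
  SameClass⇒same-part (both-out-i a∈i b∈i _ _) = trans a∈i (sym b∈i)
  SameClass⇒same-part (both-in-i  a∈i b∈i _ _) = trans a∈i (sym b∈i)
  SameClass⇒same-part (both-out-j a∈j b∈j _ _) = trans a∈j (sym b∈j)
  SameClass⇒same-part (both-in-j  a∈j b∈j _ _) = trans a∈j (sym b∈j)

  no-arc-within : ∀ {a t c} → part a ≡ c → part t ≡ c → ¬ D a t
  no-arc-within a∈c t∈c at = arc⇒parts-≢ at (trans a∈c (sym t∈c))

  -- Every arc between classes goes forward along out-j, out-i, in-j, in-i.
  SameClass⇒same-out : ∀ {a b t} → SameClass a b → D a t → D b t
  SameClass⇒same-out {t = t} (both-out-i a∈i b∈i w₀a w₀b) at with place t
  ... | at-w₀ refl    = ⊥-elim (arc-asym w₀a at)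
  ... | out-i t∈i _   = ⊥-elim (no-arc-within a∈i t∈i at)
  ... | in-i  t∈i _   = ⊥-elim (no-arc-within a∈i t∈i at)
  ... | out-j t∈j w₀t = ⊥-elim (arc-asym at (out-j⇒out-i a∈i t∈j w₀a w₀t))
  ... | in-j  t∈j tw₀ = out⇒in w₀b tw₀ (i≁j b∈i t∈j)
  SameClass⇒same-out {t = t} (both-in-i a∈i b∈i aw₀ bw₀) at with place t
  ... | at-w₀ refl    = bw₀
  ... | out-i t∈i _   = ⊥-elim (no-arc-within a∈i t∈i at)
  ... | in-i  t∈i _   = ⊥-elim (no-arc-within a∈i t∈i at)
  ... | out-j t∈j w₀t = ⊥-elim (arc-asym at (out⇒in w₀t aw₀ (j≁i t∈j a∈i)))
  ... | in-j  t∈j tw₀ = ⊥-elim (arc-asym at (in-j⇒in-i a∈i t∈j aw₀ tw₀))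
  SameClass⇒same-out {t = t} (both-out-j a∈j b∈j w₀a w₀b) at with place t
  ... | at-w₀ refl    = ⊥-elim (arc-asym w₀a at)
  ... | out-i t∈i w₀t = out-j⇒out-i t∈i b∈j w₀t w₀b
  ... | in-i  t∈i tw₀ = out⇒in w₀b tw₀ (j≁i b∈j t∈i)
  ... | out-j t∈j _   = ⊥-elim (no-arc-within a∈j t∈j at)
  ... | in-j  t∈j _   = ⊥-elim (no-arc-within a∈j t∈j at)
  SameClass⇒same-out {t = t} (both-in-j a∈j b∈j aw₀ bw₀) at with place t
  ... | at-w₀ refl    = bw₀
  ... | out-i t∈i w₀t = ⊥-elim (arc-asym at (out⇒in w₀t aw₀ (i≁j t∈i a∈j)))
  ... | in-i  t∈i tw₀ = in-j⇒in-i t∈i b∈j tw₀ bw₀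
  ... | out-j t∈j _   = ⊥-elim (no-arc-within a∈j t∈j at)
  ... | in-j  t∈j _   = ⊥-elim (no-arc-within a∈j t∈j at)

  SameClass⇒≡ : ∀ {a b} → SameClass a b → a ≡ b
  SameClass⇒≡ c = same-out⇒≡ (SameClass⇒same-part c)
    (SameClass⇒same-out c) (SameClass⇒same-out (SameClass-sym c))

  -- One vertex suffices because in-i and out-j are not both inhabited.
  spare : Σ (Vertex n) λ e → (∀ {v} → part v ≡ i → D v w₀ → v ≡ e)
                           × (∀ {v} → part v ≡ j → D w₀ v → v ≡ e)
  spare with vertex-search (λ q → (part q ≟ᶠ i) ×-dec arc? q w₀)
  ... | yes (q , q∈i , qw₀) =
          q , (λ v∈i vw₀ → SameClass⇒≡ (both-in-i v∈i q∈i vw₀ qw₀))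
            , (λ v∈j w₀v → ⊥-elim (¬in-i×out-j q∈i v∈j qw₀ w₀v))
  ... | no ∄q with vertex-search (λ r → (part r ≟ᶠ j) ×-dec arc? w₀ r)
  ...   | yes (r , r∈j , w₀r) =
            r , (λ v∈i vw₀ → ⊥-elim (∄q (_ , v∈i , vw₀)))
              , (λ v∈j w₀v → SameClass⇒≡ (both-out-j v∈j r∈j w₀v w₀r))
  ...   | no ∄r =
            w₀ , (λ v∈i vw₀ → ⊥-elim (∄q (_ , v∈i , vw₀)))
               , (λ v∈j w₀v → ⊥-elim (∄r (_ , v∈j , w₀v)))

  covering : List (Vertex n)
  covering = w₀ ∷ x ∷ y ∷ proj₁ spare ∷ []

  ∈-covering : ∀ v → v ∈ covering
  ∈-covering v with place v
  ... | at-w₀ v≡w₀    = here v≡w₀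
  ... | out-i v∈i w₀v = there (here (SameClass⇒≡ (both-out-i v∈i refl w₀v w₀x)))
  ... | in-j  v∈j vw₀ = there (there (here (SameClass⇒≡ (both-in-j v∈j refl vw₀ yw₀))))
  ... | in-i  v∈i vw₀ = there (there (there (here (proj₁ (proj₂ spare) v∈i vw₀))))
  ... | out-j v∈j w₀v = there (there (there (here (proj₂ (proj₂ spare) v∈j w₀v))))

module _ {n : Fin 3 → ℕ} (positive : ∀ i → 0 < n i) (large : 5 ≤ n 0F + n 1F + n 2F)
  {D : Digraph (Vertex n)} (orient : IsOrientationOfK3 n D)
  (twin-free : ∀ u v → u ≢ v → ¬ TrueTwins D u v) where

  open Orientation orient

  arc⇒short-walk : ∀ {x y} → D x y → NicheWalk≤ D 4 x y
  arc⇒short-walk {x} {y} xy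
    with walk? _≟ᵛ_ vertex-search (niche? D _≟ᵛ_ vertex-search arc?) 4 x y
  ... | yes walk   = walk
  ... | no no-walk = ⊥-elim (n≮n 4 (≤-trans large (vertex-count-≤ covering ∈-covering)))
    where open NoShortWalk positive orient twin-free xy no-walk

  parts-≢⇒connected : ∀ u v → part u ≢ part v → Star (NicheAdj D) u v
  parts-≢⇒connected u v u≁v with arc-total u≁v
  ... | inj₁ uv = Walk≤⇒Star (arc⇒short-walk uv)
  ... | inj₂ vu = reverse (niche-sym D) (Walk≤⇒Star (arc⇒short-walk vu))

  niche-connected : Connected (NicheAdj D)
  niche-connected u v with part u ≟ᶠ part v
  ... | no u≁v  = parts-≢⇒connected u v u≁v
  ... | yes u≈v = parts-≢⇒connected u z (z≁u ∘ sym) ◅◅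
                  parts-≢⇒connected z v (λ z≈v → z≁u (trans z≈v (sym u≈v)))
    where
      z : Vertex n
      z = punchIn (part u) 0F , fromℕ< (positive _)

      z≁u : part z ≢ part u
      z≁u = punchInᵢ≢i (part u) 0F

lemma3p7 : (n : Fin 3 → ℕ) → (∀ i → 0 < n i) →
           5 ≤ n zero + n (suc zero) + n (suc (suc zero)) →
           (D : Digraph (Vertex n)) → IsOrientationOfK3 n D →
           (∀ u v → ¬ (u ≡ v) → ¬ TrueTwins D u v) →
           Connected (NicheAdj D)
lemma3p7 n positive large D orient twin-free = niche-connected positive large orient twin-free
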